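{- Let $(A,m,\bullet,\Delta)$ be a Com-PreLie bialgebra over a field $\mathbb{K}$ of characteristic zero such that the bialgebra $(A,m,\Delta)$ is conilpotent (hence a Hopf algebra), and let $S$ be its antipode. Then for all $a,b\in A$, \[S(a\bullet b)=\left(S(a)\bullet b^{(1)}\right)S\left(b^{(2)}\right),\] where $\Delta(b)=b^{(1)}\otimes b^{(2)}$ in Sweedler's notation.
   Context: A (right) Com-PreLie algebra is a vector space $A$ with two bilinear products, $m:(a,b)\mapsto ab$ and $\bullet$, such that $m$ is commutative and associative, $\bullet$ satisfies the right preLie identity $(a\bullet b)\bullet c-a\bullet(b\bullet c)=(a\bullet c)\bullet b-a\bullet(c\bullet b)$, and the Leibniz identity $(ab)\bullet c=(a\bullet c)b+a(b\bullet c)$ holds for all $a,b,c\in A$. A Com-PreLie bialgebra is a family $(A,m,\bullet,\Delta)$ such that $(A,m,\bullet)$ is a Com-PreLie algebra with $(A,m)$ unitary, $(A,m,\Delta)$ is a bialgebra, and for all $a,b\in A$, $\Delta(a\bullet b)=a^{(1)}\otimes a^{(2)}\bullet b+a^{(1)}\bullet b^{(1)}\otimes a^{(2)}b^{(2)}$ (Sweedler's notation). With counit $\varepsilon$, let $A_+=\ker\varepsilon$ and $\tilde\Delta(a)=\Delta(a)-a\otimes 1-1\otimes a$ for $a\in A_+$, with iterates $\tilde\Delta^{(0)}=\mathrm{Id}$, $\tilde\Delta^{(n)}=(\tilde\Delta\otimes\mathrm{Id}^{\otimes(n-1)})\circ\tilde\Delta^{(n-1)}$. The bialgebra is conilpotent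 if for every $a\in A_+$ there is $N\ge1$ with $\tilde\Delta^{(N)}(a)=0$. -}

module Defs where

open import Level using (Level; _⊔_) renaming (suc to lsuc)
open import Algebra.Bundles using (CommutativeRing)
open import Algebra.Module.Bundles using (Module)
open import Data.Nat using (ℕ; zero; suc; _≤_)
open import Data.Fin using (Fin)
open import Data.Vec using (Vec; []; _∷_; _[_]≔_)
open import Data.Vec.Relation.Binary.Pointwise.Inductive using (Pointwise)
open import Data.List using (List; []; _∷_; map; foldr; concatMap; _++_)
open import Data.Product using (Σ; ∃; _×_; _,_)
open import Relation.Nullary using (¬_)

record Field c ℓ : Set (lsuc (c ⊔ ℓ)) where
  field
    commutativeRing : CommutativeRing c ℓ
  open CommutativeRing commutativeRing public
  field
    1≉0     : ¬ (1# ≈ 0#)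
    inverse : ∀ x → ¬ (x ≈ 0#) → Σ Carrier (λ y → (x * y) ≈ 1#)

module _ {c ℓ} (K : Field c ℓ) where
  open Field K

  ℕ→K : ℕ → Carrier
  ℕ→K zero    = 0#
  ℕ→K (suc n) = 1# + ℕ→K n

  CharacteristicZero : Set ℓ
  CharacteristicZero = ∀ n → ¬ (ℕ→K (suc n) ≈ 0#)

-- Tensor powers of a K-vector space, via the universal property.
-- An element of A^{⊗n} is represented by a finite sum of pure tensors
-- x₁ ⊗ ... ⊗ xₙ (scalars absorbed into a factor), i.e. a List (Vec A n).
-- Two such sums are equal in A^{⊗n} iff every n-multilinear map out of
-- A^n into any K-vector space V takes the same value on them.

module Tensors {c ℓ} (K : Field c ℓ)
               (M : Module (Field.commutativeRing K) c ℓ) where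
  open Field K
  open Module M

  Tensor : ℕ → Set c
  Tensor n = List (Vec Carrierᴹ n)

  module _ (V : Module (Field.commutativeRing K) c ℓ) where
    private module V = Module V

    record Multilinear {n : ℕ} (f : Vec Carrierᴹ n → V.Carrierᴹ) : Set (c ⊔ ℓ) where
      field
        cong     : ∀ {v w} → Pointwise _≈ᴹ_ v w → f v V.≈ᴹ f w
        additive : ∀ (v : Vec Carrierᴹ n) (i : Fin n) (x y : Carrierᴹ) →
                   f (v [ i ]≔ (x +ᴹ y)) V.≈ᴹ (f (v [ i ]≔ x) V.+ᴹ f (v [ i ]≔ y))
        homog    : ∀ (v : Vec Carrierᴹ n) (i : Fin n) (k : Carrier) (x : Carrierᴹ) →
                   f (v [ i ]≔ (k *ₗ x)) V.≈ᴹ (k V.*ₗ f (v [ i ]≔ x))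

    sumV : List V.Carrierᴹ → V.Carrierᴹ
    sumV = foldr V._+ᴹ_ V.0ᴹ

  infix 4 _≈⊗_
  _≈⊗_ : ∀ {n} → Tensor n → Tensor n → Set (lsuc (c ⊔ ℓ))
  _≈⊗_ {n} t u = ∀ (V : Module (Field.commutativeRing K) c ℓ)
                   (f : Vec Carrierᴹ n → Module.Carrierᴹ V) →
                   Multilinear V f →
                   Module._≈ᴹ_ V (sumV V (map f t)) (sumV V (map f u))

  ΣA : List Carrierᴹ → Carrierᴹ
  ΣA = foldr _+ᴹ_ 0ᴹ

  T2 : List (Carrierᴹ × Carrierᴹ) → Tensor 2
  T2 = map (λ { (x , y) → x ∷ y ∷ [] })

record ComPreLieBialgebra {c ℓ} (K : Field c ℓ)
                          (M : Module (Field.commutativeRing K) c ℓ)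
                          : Set (lsuc (c ⊔ ℓ)) where
  open Field K
  open Module M
  open Tensors K M
  infixl 7 _·_
  infixl 8 _•_
  field
    _·_   : Carrierᴹ → Carrierᴹ → Carrierᴹ
    1A    : Carrierᴹ
    _•_   : Carrierᴹ → Carrierᴹ → Carrierᴹ
    Δ     : Carrierᴹ → List (Carrierᴹ × Carrierᴹ)
    ε     : Carrierᴹ → Carrier

    ·-cong      : ∀ {a a' b b'} → a ≈ᴹ a' → b ≈ᴹ b' → a · b ≈ᴹ a' · b'
    ·-distribʳ  : ∀ a b d → (a +ᴹ b) · d ≈ᴹ a · d +ᴹ b · d
    ·-scalarˡ   : ∀ k a b → (k *ₗ a) · b ≈ᴹ k *ₗ (a · b)
    ·-comm      : ∀ a b → a · b ≈ᴹ b · a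
    ·-assoc     : ∀ a b d → (a · b) · d ≈ᴹ a · (b · d)
    ·-identityˡ : ∀ a → 1A · a ≈ᴹ a

    •-cong      : ∀ {a a' b b'} → a ≈ᴹ a' → b ≈ᴹ b' → a • b ≈ᴹ a' • b'
    •-distribʳ  : ∀ a b d → (a +ᴹ b) • d ≈ᴹ a • d +ᴹ b • d
    •-distribˡ  : ∀ a b d → a • (b +ᴹ d) ≈ᴹ a • b +ᴹ a • d
    •-scalarˡ   : ∀ k a b → (k *ₗ a) • b ≈ᴹ k *ₗ (a • b)
    •-scalarʳ   : ∀ k a b → a • (k *ₗ b) ≈ᴹ k *ₗ (a • b)
    preLie      : ∀ a b d → (a • b) • d +ᴹ -ᴹ (a • (b • d))
                            ≈ᴹ (a • d) • b +ᴹ -ᴹ (a • (d • b))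
    leibniz     : ∀ a b d → (a · b) • d ≈ᴹ (a • d) · b +ᴹ a · (b • d)

    Δ-cong      : ∀ {a b} → a ≈ᴹ b → T2 (Δ a) ≈⊗ T2 (Δ b)
    Δ-+         : ∀ a b → T2 (Δ (a +ᴹ b)) ≈⊗ T2 (Δ a ++ Δ b)
    Δ-*         : ∀ k a → T2 (Δ (k *ₗ a)) ≈⊗ T2 (map (λ { (x , y) → (k *ₗ x , y) }) (Δ a))
    Δ-coassoc   : ∀ a →
      concatMap (λ { (x , y) → map (λ { (x₁ , x₂) → x₁ ∷ x₂ ∷ y ∷ [] }) (Δ x) }) (Δ a)
      ≈⊗ concatMap (λ { (x , y) → map (λ { (y₁ , y₂) → x ∷ y₁ ∷ y₂ ∷ [] }) (Δ y) }) (Δ a)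
    ε-cong      : ∀ {a b} → a ≈ᴹ b → ε a ≈ ε b
    ε-+         : ∀ a b → ε (a +ᴹ b) ≈ ε a + ε b
    ε-*         : ∀ k a → ε (k *ₗ a) ≈ k * ε a
    counitˡ     : ∀ a → ΣA (map (λ { (x , y) → ε x *ₗ y }) (Δ a)) ≈ᴹ a
    counitʳ     : ∀ a → ΣA (map (λ { (x , y) → ε y *ₗ x }) (Δ a)) ≈ᴹ a
    Δ-·         : ∀ a b → T2 (Δ (a · b)) ≈⊗
      T2 (concatMap (λ { (x₁ , x₂) → map (λ { (y₁ , y₂) → (x₁ · y₁ , x₂ · y₂) }) (Δ b) }) (Δ a))
    Δ-1         : T2 (Δ 1A) ≈⊗ T2 ((1A , 1A) ∷ [])
    ε-·         : ∀ a b → ε (a · b) ≈ ε a * ε b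
    ε-1         : ε 1A ≈ 1#

    Δ-•         : ∀ a b → T2 (Δ (a • b)) ≈⊗
      T2 (map (λ { (x₁ , x₂) → (x₁ , x₂ • b) }) (Δ a)
          ++ concatMap (λ { (x₁ , x₂) → map (λ { (y₁ , y₂) → (x₁ • y₁ , x₂ · y₂) }) (Δ b) }) (Δ a))

module ComPreLieBialgebraTheory {c ℓ} {K : Field c ℓ}
         {M : Module (Field.commutativeRing K) c ℓ}
         (B : ComPreLieBialgebra K M) where
  open Field K
  open Module M
  open Tensors K M
  open ComPreLieBialgebra B

  Δ̃ : Carrierᴹ → List (Carrierᴹ × Carrierᴹ)
  Δ̃ a = Δ a ++ ((-ᴹ a , 1A) ∷ (-ᴹ 1A , a) ∷ [])

  Δ̃⊗Id : ∀ {n} → Tensor (suc n) → Tensor (suc (suc n))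
  Δ̃⊗Id = concatMap (λ { (x ∷ xs) → map (λ { (y , z) → y ∷ z ∷ xs }) (Δ̃ x) })

  Δ̃^ : (n : ℕ) → Carrierᴹ → Tensor (suc n)
  Δ̃^ zero    a = (a ∷ []) ∷ []
  Δ̃^ (suc n) a = Δ̃⊗Id (Δ̃^ n a)

  Conilpotent : Set (lsuc (c ⊔ ℓ))
  Conilpotent = ∀ a → ε a ≈ 0# → Σ ℕ (λ N → (1 ≤ N) × (Δ̃^ N a ≈⊗ []))

  record IsAntipode (S : Carrierᴹ → Carrierᴹ) : Set (c ⊔ ℓ) where
    field
      S-cong : ∀ {a b} → a ≈ᴹ b → S a ≈ᴹ S b
      S-+    : ∀ a b → S (a +ᴹ b) ≈ᴹ S a +ᴹ S b
      S-*    : ∀ k a → S (k *ₗ a) ≈ᴹ k *ₗ S a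
      S-left  : ∀ a → ΣA (map (λ { (x , y) → S x · y }) (Δ a)) ≈ᴹ ε a *ₗ 1A
      S-right : ∀ a → ΣA (map (λ { (x , y) → x · S y }) (Δ a)) ≈ᴹ ε a *ₗ 1A

{-# OPTIONS --safe #-}
-- Write (f ⋆ g)(x) = Σ f(x₁) g(x₂) for the convolution of linear endomorphisms of A.
-- Since S is the ⋆-inverse of id, coassociativity gives F = (F ⋆ id) ⋆ S for every
-- linear F, so F is determined by F ⋆ id. For F = S(a • –) this reduces the theorem to
-- (S(a • –) ⋆ id)(b) = S(a) • b, and the same cancellation in the variable a reduces
-- that to Σ S(a₁ • b₁) a₂ b₂ = Σ (S(a₁) • b) a₂. Both sides are the negative of
-- Σ S(a₁) (a₂ • b): the left one by the antipode axiom at a • b, expanded with the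
-- compatibility of Δ with • and ε(a • b) = 0; the right one by the Leibniz rule applied
-- to Σ S(a₁) a₂ = ε(a) 1, since 1 • b = 0.
module Submission where

open import Defs
open import Level using (Level; _⊔_)
open import Function using (id; _∘_)
open import Algebra.Bundles using (CommutativeMonoid)
open import Algebra.Module.Bundles using (Module)
import Algebra.Properties.CommutativeSemigroup as CommutativeSemigroupProperties
import Algebra.Properties.Group as GroupProperties
open import Data.List using (List; []; _∷_; map; _++_; concatMap)
open import Data.List.Properties using (map-∘)
open import Data.Product using (_×_; _,_; uncurry)
open import Data.Fin using (zero; suc)
open import Data.Vec using (_∷_; [])
open import Data.Vec.N-ary using (_$ⁿ_)
open import Data.Vec.Relation.Binary.Pointwise.Inductive using (_∷_; [])
import Relation.Binary.PropositionalEquality as ≡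
import Relation.Binary.Reasoning.Setoid as SetoidReasoning

module LinearAlgebra {c ℓ} (K : Field c ℓ) (M : Module (Field.commutativeRing K) c ℓ) where
  open Module M
  open Tensors K M
  open SetoidReasoning ≈ᴹ-setoid
  open CommutativeSemigroupProperties
    (CommutativeMonoid.commutativeSemigroup +ᴹ-commutativeMonoid) using (interchange)

  private
    variable
      a : Level
      X Y : Set a
    A : Set c
    A = Carrierᴹ

  ΣA-cong : {f g : X → A} (xs : List X) → (∀ x → f x ≈ᴹ g x) →
            ΣA (map f xs) ≈ᴹ ΣA (map g xs)
  ΣA-cong []       f≈g = ≈ᴹ-refl
  ΣA-cong (x ∷ xs) f≈g = +ᴹ-cong (f≈g x) (ΣA-cong xs f≈g)

  ΣA-+ᴹ : (f g : X → A) (xs : List X) →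
          ΣA (map (λ x → f x +ᴹ g x) xs) ≈ᴹ ΣA (map f xs) +ᴹ ΣA (map g xs)
  ΣA-+ᴹ f g []       = ≈ᴹ-sym (+ᴹ-identityˡ 0ᴹ)
  ΣA-+ᴹ f g (x ∷ xs) = ≈ᴹ-trans (+ᴹ-congˡ (ΣA-+ᴹ f g xs)) (interchange _ _ _ _)

  ΣA-++ : (f : X → A) (xs ys : List X) →
          ΣA (map f (xs ++ ys)) ≈ᴹ ΣA (map f xs) +ᴹ ΣA (map f ys)
  ΣA-++ f []       ys = ≈ᴹ-sym (+ᴹ-identityˡ _)
  ΣA-++ f (x ∷ xs) ys = ≈ᴹ-trans (+ᴹ-congˡ (ΣA-++ f xs ys)) (≈ᴹ-sym (+ᴹ-assoc _ _ _))

  ΣA-concatMap : (f : Y → A) (g : X → List Y) (xs : List X) →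
                 ΣA (map f (concatMap g xs)) ≈ᴹ ΣA (map (λ x → ΣA (map f (g x))) xs)
  ΣA-concatMap f g []       = ≈ᴹ-refl
  ΣA-concatMap f g (x ∷ xs) =
    ≈ᴹ-trans (ΣA-++ f (g x) (concatMap g xs)) (+ᴹ-congˡ (ΣA-concatMap f g xs))

  ΣA-map : (f : Y → A) (g : X → Y) (xs : List X) → ΣA (map (f ∘ g) xs) ≈ᴹ ΣA (map f (map g xs))
  ΣA-map f g xs = ≈ᴹ-reflexive (≡.cong ΣA (map-∘ xs))

  record IsLinear (f : A → A) : Set (c ⊔ ℓ) where
    field
      ⟦⟧-cong : ∀ {x y} → x ≈ᴹ y → f x ≈ᴹ f y
      +ᴹ-homo : ∀ x y → f (x +ᴹ y) ≈ᴹ f x +ᴹ f y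
      *ₗ-homo : ∀ k x → f (k *ₗ x) ≈ᴹ k *ₗ f x

  open IsLinear public

  linear-0ᴹ : ∀ {f} → IsLinear f → f 0ᴹ ≈ᴹ 0ᴹ
  linear-0ᴹ {f} f-lin = begin
    f 0ᴹ          ≈⟨ ⟦⟧-cong f-lin (*ₗ-zeroˡ 0ᴹ) ⟨
    f (0# *ₗ 0ᴹ)  ≈⟨ *ₗ-homo f-lin 0# 0ᴹ ⟩
    0# *ₗ f 0ᴹ    ≈⟨ *ₗ-zeroˡ (f 0ᴹ) ⟩
    0ᴹ            ∎
    where open Field K using (0#)

  linear-ΣA : ∀ {f} → IsLinear f → (g : X → A) (xs : List X) →
              f (ΣA (map g xs)) ≈ᴹ ΣA (map (f ∘ g) xs)
  linear-ΣA f-lin g []       = linear-0ᴹ f-lin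
  linear-ΣA f-lin g (x ∷ xs) = ≈ᴹ-trans (+ᴹ-homo f-lin _ _) (+ᴹ-congˡ (linear-ΣA f-lin g xs))

  linear-resp-≈ : ∀ {f g} → IsLinear f → (∀ x → f x ≈ᴹ g x) → IsLinear g
  linear-resp-≈ f-lin f≈g = record
    { ⟦⟧-cong = λ x≈y → ≈ᴹ-trans (≈ᴹ-sym (f≈g _)) (≈ᴹ-trans (⟦⟧-cong f-lin x≈y) (f≈g _))
    ; +ᴹ-homo = λ x y → ≈ᴹ-trans (≈ᴹ-sym (f≈g _))
                          (≈ᴹ-trans (+ᴹ-homo f-lin x y) (+ᴹ-cong (f≈g x) (f≈g y)))
    ; *ₗ-homo = λ k x → ≈ᴹ-trans (≈ᴹ-sym (f≈g _)) (≈ᴹ-trans (*ₗ-homo f-lin k x) (*ₗ-congˡ (f≈g x)))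
    }

  ∘-linear : ∀ {f g} → IsLinear f → IsLinear g → IsLinear (f ∘ g)
  ∘-linear f-lin g-lin = record
    { ⟦⟧-cong = ⟦⟧-cong f-lin ∘ ⟦⟧-cong g-lin
    ; +ᴹ-homo = λ x y → ≈ᴹ-trans (⟦⟧-cong f-lin (+ᴹ-homo g-lin x y)) (+ᴹ-homo f-lin _ _)
    ; *ₗ-homo = λ k x → ≈ᴹ-trans (⟦⟧-cong f-lin (*ₗ-homo g-lin k x)) (*ₗ-homo f-lin _ _)
    }

  *ₗ-linear : ∀ k → IsLinear (k *ₗ_)
  *ₗ-linear k = record
    { ⟦⟧-cong = *ₗ-congˡ
    ; +ᴹ-homo = *ₗ-distribˡ k
    ; *ₗ-homo = *ₗ-comm k
    }

  ΣA-linear : (F : X → A → A) (xs : List X) → (∀ x → IsLinear (F x)) →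
              IsLinear (λ v → ΣA (map (λ x → F x v) xs))
  ΣA-linear F xs F-lin = record
    { ⟦⟧-cong = λ v≈w → ΣA-cong xs (λ x → ⟦⟧-cong (F-lin x) v≈w)
    ; +ᴹ-homo = λ v w → ≈ᴹ-trans (ΣA-cong xs (λ x → +ᴹ-homo (F-lin x) v w)) (ΣA-+ᴹ _ _ xs)
    ; *ₗ-homo = λ k v → ≈ᴹ-trans (ΣA-cong xs (λ x → *ₗ-homo (F-lin x) k v))
                                  (≈ᴹ-sym (linear-ΣA (*ₗ-linear k) _ xs))
    }

  record IsBilinear (g : A → A → A) : Set (c ⊔ ℓ) where
    field
      linearˡ : ∀ y → IsLinear (λ x → g x y)
      linearʳ : ∀ x → IsLinear (g x)

  record IsTrilinear (t : A → A → A → A) : Set (c ⊔ ℓ) where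
    field
      linear₁ : ∀ y z → IsLinear (λ x → t x y z)
      linear₂ : ∀ x z → IsLinear (λ y → t x y z)
      linear₃ : ∀ x y → IsLinear (t x y)

  bilinear⇒multilinear : ∀ {g} → IsBilinear g → Multilinear M {n = 2} (g $ⁿ_)
  bilinear⇒multilinear g-bil = record
    { cong     = λ { {x ∷ y ∷ []} {_ ∷ y′ ∷ []} (x≈x′ ∷ y≈y′ ∷ []) →
                     ≈ᴹ-trans (⟦⟧-cong (linearˡ y) x≈x′) (⟦⟧-cong (linearʳ _) y≈y′) }
    ; additive = λ { (x ∷ y ∷ []) zero       → +ᴹ-homo (linearˡ y)
                   ; (x ∷ y ∷ []) (suc zero) → +ᴹ-homo (linearʳ x) }
    ; homog    = λ { (x ∷ y ∷ []) zero       → *ₗ-homo (linearˡ y)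
                   ; (x ∷ y ∷ []) (suc zero) → *ₗ-homo (linearʳ x) }
    }
    where open IsBilinear g-bil

  trilinear⇒multilinear : ∀ {t} → IsTrilinear t → Multilinear M {n = 3} (t $ⁿ_)
  trilinear⇒multilinear t-tri = record
    { cong     = λ { {x ∷ y ∷ z ∷ []} {_ ∷ y′ ∷ z′ ∷ []} (x≈x′ ∷ y≈y′ ∷ z≈z′ ∷ []) →
                     ≈ᴹ-trans (⟦⟧-cong (linear₁ y z) x≈x′)
                       (≈ᴹ-trans (⟦⟧-cong (linear₂ _ z) y≈y′) (⟦⟧-cong (linear₃ _ _) z≈z′)) }
    ; additive = λ { (x ∷ y ∷ z ∷ []) zero             → +ᴹ-homo (linear₁ y z)
                   ; (x ∷ y ∷ z ∷ []) (suc zero)       → +ᴹ-homo (linear₂ x z)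
                   ; (x ∷ y ∷ z ∷ []) (suc (suc zero)) → +ᴹ-homo (linear₃ x y) }
    ; homog    = λ { (x ∷ y ∷ z ∷ []) zero             → *ₗ-homo (linear₁ y z)
                   ; (x ∷ y ∷ z ∷ []) (suc zero)       → *ₗ-homo (linear₂ x z)
                   ; (x ∷ y ∷ z ∷ []) (suc (suc zero)) → *ₗ-homo (linear₃ x y) }
    }
    where open IsTrilinear t-tri

  Σ⊗ : List (A × A) → (A → A → A) → A
  Σ⊗ xs g = ΣA (map (uncurry g) xs)

  infix 5 Σ⊗
  syntax Σ⊗ xs (λ x y → e) = Σ[ x ⊗ y ∈ xs ] e

  Σ⊗-resp-≈⊗ : ∀ {g} → IsBilinear g → ∀ xs ys → T2 xs ≈⊗ T2 ys → Σ⊗ xs g ≈ᴹ Σ⊗ ys g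
  Σ⊗-resp-≈⊗ {g} g-bil xs ys xs≈ys = begin
    Σ⊗ xs g                  ≈⟨ ΣA-map (g $ⁿ_) _ xs ⟩
    ΣA (map (g $ⁿ_) (T2 xs)) ≈⟨ xs≈ys M (g $ⁿ_) (bilinear⇒multilinear g-bil) ⟩
    ΣA (map (g $ⁿ_) (T2 ys)) ≈⟨ ΣA-map (g $ⁿ_) _ ys ⟨
    Σ⊗ ys g                  ∎

module ComPreLieBialgebraProperties
  {c ℓ} {K : Field c ℓ} {M : Module (Field.commutativeRing K) c ℓ}
  (B : ComPreLieBialgebra K M) where
  open Module M
  open Tensors K M
  open ComPreLieBialgebra B
  open LinearAlgebra K M
  open GroupProperties +ᴹ-group using (identityˡ-unique; identityʳ-unique)
  open SetoidReasoning ≈ᴹ-setoid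

  private
    A : Set c
    A = Carrierᴹ

  ηε : A → A
  ηε x = ε x *ₗ 1A

  ·-identityʳ : ∀ x → x · 1A ≈ᴹ x
  ·-identityʳ x = ≈ᴹ-trans (·-comm x 1A) (·-identityˡ x)

  ·-ηε : ∀ x y → x · ηε y ≈ᴹ ε y *ₗ x
  ·-ηε x y = begin
    x · (ε y *ₗ 1A)   ≈⟨ ·-comm x _ ⟩
    (ε y *ₗ 1A) · x   ≈⟨ ·-scalarˡ (ε y) 1A x ⟩
    ε y *ₗ (1A · x)   ≈⟨ *ₗ-congˡ (·-identityˡ x) ⟩
    ε y *ₗ x          ∎

  ·-linearˡ : ∀ y → IsLinear (_· y)
  ·-linearˡ y = record
    { ⟦⟧-cong = λ x≈x′ → ·-cong x≈x′ ≈ᴹ-refl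
    ; +ᴹ-homo = λ x x′ → ·-distribʳ x x′ y
    ; *ₗ-homo = λ k x → ·-scalarˡ k x y
    }

  ·-linearʳ : ∀ x → IsLinear (x ·_)
  ·-linearʳ x = linear-resp-≈ (·-linearˡ x) (λ y → ·-comm y x)

  •-linearˡ : ∀ y → IsLinear (_• y)
  •-linearˡ y = record
    { ⟦⟧-cong = λ x≈x′ → •-cong x≈x′ ≈ᴹ-refl
    ; +ᴹ-homo = λ x x′ → •-distribʳ x x′ y
    ; *ₗ-homo = λ k x → •-scalarˡ k x y
    }

  •-linearʳ : ∀ x → IsLinear (x •_)
  •-linearʳ x = record
    { ⟦⟧-cong = •-cong ≈ᴹ-refl
    ; +ᴹ-homo = •-distribˡ x
    ; *ₗ-homo = λ k y → •-scalarʳ k x y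
    }

  •-bilinear : IsBilinear _•_
  •-bilinear = record { linearˡ = •-linearˡ ; linearʳ = •-linearʳ }

  ε-*ₗ-linear : ∀ y → IsLinear (λ x → ε x *ₗ y)
  ε-*ₗ-linear y = record
    { ⟦⟧-cong = λ x≈x′ → *ₗ-congʳ (ε-cong x≈x′)
    ; +ᴹ-homo = λ x x′ → ≈ᴹ-trans (*ₗ-congʳ (ε-+ x x′)) (*ₗ-distribʳ y (ε x) (ε x′))
    ; *ₗ-homo = λ k x → ≈ᴹ-trans (*ₗ-congʳ (ε-* k x)) (*ₗ-assoc k (ε x) y)
    }

  ηε-linear : IsLinear ηε
  ηε-linear = ε-*ₗ-linear 1A

  1A•≈0ᴹ : ∀ x → 1A • x ≈ᴹ 0ᴹ
  1A•≈0ᴹ x = identityʳ-unique (1A • x) (1A • x) (begin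
    1A • x +ᴹ 1A • x               ≈⟨ +ᴹ-cong (·-identityʳ _) (·-identityˡ _) ⟨
    (1A • x) · 1A +ᴹ 1A · (1A • x) ≈⟨ leibniz 1A 1A x ⟨
    (1A · 1A) • x                  ≈⟨ •-cong (·-identityˡ 1A) ≈ᴹ-refl ⟩
    1A • x                         ∎)

  linear-counitʳ : ∀ {f} → IsLinear f → ∀ x → Σ[ x₁ ⊗ x₂ ∈ Δ x ] ε x₂ *ₗ f x₁ ≈ᴹ f x
  linear-counitʳ {f} f-lin x = begin
    Σ[ x₁ ⊗ x₂ ∈ Δ x ] ε x₂ *ₗ f x₁   ≈⟨ ΣA-cong (Δ x) (λ (x₁ , x₂) → *ₗ-homo f-lin (ε x₂) x₁) ⟨
    Σ[ x₁ ⊗ x₂ ∈ Δ x ] f (ε x₂ *ₗ x₁) ≈⟨ linear-ΣA f-lin _ (Δ x) ⟨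
    f (Σ[ x₁ ⊗ x₂ ∈ Δ x ] ε x₂ *ₗ x₁) ≈⟨ ⟦⟧-cong f-lin (counitʳ x) ⟩
    f x                               ∎

  Σ-Δ-coassoc : ∀ {t} → IsTrilinear t → ∀ x →
    Σ[ x₁ ⊗ x₂ ∈ Δ x ] Σ[ y₁ ⊗ y₂ ∈ Δ x₁ ] t y₁ y₂ x₂ ≈ᴹ
    Σ[ x₁ ⊗ x₂ ∈ Δ x ] Σ[ y₁ ⊗ y₂ ∈ Δ x₂ ] t x₁ y₁ y₂
  Σ-Δ-coassoc {t} t-tri x = begin
    Σ[ x₁ ⊗ x₂ ∈ Δ x ] Σ[ y₁ ⊗ y₂ ∈ Δ x₁ ] t y₁ y₂ x₂
      ≈⟨ ΣA-cong (Δ x) (λ (x₁ , x₂) → ΣA-map (t $ⁿ_) (λ (y₁ , y₂) → y₁ ∷ y₂ ∷ x₂ ∷ []) (Δ x₁)) ⟩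
    ΣA (map (λ x₁x₂ → ΣA (map (t $ⁿ_) (outer x₁x₂))) (Δ x))
      ≈⟨ ΣA-concatMap (t $ⁿ_) outer (Δ x) ⟨
    ΣA (map (t $ⁿ_) (concatMap outer (Δ x)))
      ≈⟨ Δ-coassoc x M (t $ⁿ_) (trilinear⇒multilinear t-tri) ⟩
    ΣA (map (t $ⁿ_) (concatMap inner (Δ x)))
      ≈⟨ ΣA-concatMap (t $ⁿ_) inner (Δ x) ⟩
    ΣA (map (λ x₁x₂ → ΣA (map (t $ⁿ_) (inner x₁x₂))) (Δ x))
      ≈⟨ ΣA-cong (Δ x) (λ (x₁ , x₂) → ΣA-map (t $ⁿ_) (λ (y₁ , y₂) → x₁ ∷ y₁ ∷ y₂ ∷ []) (Δ x₂)) ⟨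
    Σ[ x₁ ⊗ x₂ ∈ Δ x ] Σ[ y₁ ⊗ y₂ ∈ Δ x₂ ] t x₁ y₁ y₂ ∎
    where
    outer inner : A × A → Tensor 3
    outer (x₁ , x₂) = map (λ (y₁ , y₂) → y₁ ∷ y₂ ∷ x₂ ∷ []) (Δ x₁)
    inner (x₁ , x₂) = map (λ (y₁ , y₂) → x₁ ∷ y₁ ∷ y₂ ∷ []) (Δ x₂)

  Σ-Δ-• : ∀ {g} → IsBilinear g → ∀ x y →
    Σ[ z₁ ⊗ z₂ ∈ Δ (x • y) ] g z₁ z₂ ≈ᴹ
    (Σ[ x₁ ⊗ x₂ ∈ Δ x ] g x₁ (x₂ • y)) +ᴹ
    (Σ[ x₁ ⊗ x₂ ∈ Δ x ] Σ[ y₁ ⊗ y₂ ∈ Δ y ] g (x₁ • y₁) (x₂ · y₂))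
  Σ-Δ-• {g} g-bil x y = begin
    Σ⊗ (Δ (x • y)) g
      ≈⟨ Σ⊗-resp-≈⊗ g-bil (Δ (x • y)) (map right-• (Δ x) ++ concatMap cross (Δ x)) (Δ-• x y) ⟩
    Σ⊗ (map right-• (Δ x) ++ concatMap cross (Δ x)) g
      ≈⟨ ΣA-++ (uncurry g) (map right-• (Δ x)) _ ⟩
    Σ⊗ (map right-• (Δ x)) g +ᴹ Σ⊗ (concatMap cross (Δ x)) g
      ≈⟨ +ᴹ-cong (≈ᴹ-sym (ΣA-map (uncurry g) right-• (Δ x)))
                 (≈ᴹ-trans (ΣA-concatMap (uncurry g) cross (Δ x))
                   (ΣA-cong (Δ x) (λ _ → ≈ᴹ-sym (ΣA-map (uncurry g) _ (Δ y))))) ⟩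
    (Σ[ x₁ ⊗ x₂ ∈ Δ x ] g x₁ (x₂ • y)) +ᴹ
    (Σ[ x₁ ⊗ x₂ ∈ Δ x ] Σ[ y₁ ⊗ y₂ ∈ Δ y ] g (x₁ • y₁) (x₂ · y₂)) ∎
    where
    right-• : A × A → A × A
    right-• (x₁ , x₂) = x₁ , x₂ • y
    cross : A × A → List (A × A)
    cross (x₁ , x₂) = map (λ (y₁ , y₂) → x₁ • y₁ , x₂ · y₂) (Δ y)

  counitʳ-⊗ : ∀ {g} → IsBilinear g → ∀ x y →
    Σ[ x₁ ⊗ x₂ ∈ Δ x ] Σ[ y₁ ⊗ y₂ ∈ Δ y ] ε (x₂ · y₂) *ₗ g x₁ y₁ ≈ᴹ g x y
  counitʳ-⊗ {g} g-bil x y = begin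
    Σ[ x₁ ⊗ x₂ ∈ Δ x ] Σ[ y₁ ⊗ y₂ ∈ Δ y ] ε (x₂ · y₂) *ₗ g x₁ y₁
      ≈⟨ ΣA-cong (Δ x) (λ (x₁ , x₂) → ΣA-cong (Δ y) (λ (y₁ , y₂) →
           ≈ᴹ-trans (*ₗ-congʳ (ε-· x₂ y₂)) (*ₗ-assoc (ε x₂) (ε y₂) (g x₁ y₁)))) ⟩
    Σ[ x₁ ⊗ x₂ ∈ Δ x ] Σ[ y₁ ⊗ y₂ ∈ Δ y ] ε x₂ *ₗ ε y₂ *ₗ g x₁ y₁
      ≈⟨ ΣA-cong (Δ x) (λ (_ , x₂) → linear-ΣA (*ₗ-linear (ε x₂)) _ (Δ y)) ⟨
    Σ[ x₁ ⊗ x₂ ∈ Δ x ] ε x₂ *ₗ (Σ[ y₁ ⊗ y₂ ∈ Δ y ] ε y₂ *ₗ g x₁ y₁)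
      ≈⟨ ΣA-cong (Δ x) (λ (x₁ , _) → *ₗ-congˡ (linear-counitʳ (linearʳ x₁) y)) ⟩
    Σ[ x₁ ⊗ x₂ ∈ Δ x ] ε x₂ *ₗ g x₁ y
      ≈⟨ linear-counitʳ (linearˡ y) x ⟩
    g x y ∎
    where open IsBilinear g-bil

  Σ-ε•*ₗ≈0ᴹ : ∀ x y → Σ[ x₁ ⊗ x₂ ∈ Δ x ] ε (x₂ • y) *ₗ x₁ ≈ᴹ 0ᴹ
  Σ-ε•*ₗ≈0ᴹ x y = identityˡ-unique _ (x • y) (begin
    (Σ[ x₁ ⊗ x₂ ∈ Δ x ] ε (x₂ • y) *ₗ x₁) +ᴹ x • y
      ≈⟨ +ᴹ-congˡ (counitʳ-⊗ •-bilinear x y) ⟨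
    (Σ[ x₁ ⊗ x₂ ∈ Δ x ] ε (x₂ • y) *ₗ x₁) +ᴹ
    (Σ[ x₁ ⊗ x₂ ∈ Δ x ] Σ[ y₁ ⊗ y₂ ∈ Δ y ] ε (x₂ · y₂) *ₗ (x₁ • y₁))
      ≈⟨ Σ-Δ-• ε-*ₗ-bilinear x y ⟨
    Σ[ z₁ ⊗ z₂ ∈ Δ (x • y) ] ε z₂ *ₗ z₁
      ≈⟨ counitʳ (x • y) ⟩
    x • y ∎)
    where
    ε-*ₗ-bilinear : IsBilinear (λ z₁ z₂ → ε z₂ *ₗ z₁)
    ε-*ₗ-bilinear = record { linearˡ = λ z₂ → *ₗ-linear (ε z₂) ; linearʳ = ε-*ₗ-linear }

  ηε-•≈0ᴹ : ∀ x y → ηε (x • y) ≈ᴹ 0ᴹ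
  ηε-•≈0ᴹ x y = begin
    ηε (x • y)
      ≈⟨ ⟦⟧-cong ηε[•y]-linear (counitˡ x) ⟨
    ηε ((Σ[ x₁ ⊗ x₂ ∈ Δ x ] ε x₁ *ₗ x₂) • y)
      ≈⟨ linear-ΣA ηε[•y]-linear _ (Δ x) ⟩
    Σ[ x₁ ⊗ x₂ ∈ Δ x ] ηε ((ε x₁ *ₗ x₂) • y)
      ≈⟨ ΣA-cong (Δ x) (λ (x₁ , x₂) → begin
           ηε ((ε x₁ *ₗ x₂) • y)       ≈⟨ *ₗ-homo ηε[•y]-linear (ε x₁) x₂ ⟩
           ε x₁ *ₗ ε (x₂ • y) *ₗ 1A    ≈⟨ *ₗ-comm (ε x₁) (ε (x₂ • y)) 1A ⟩
           ε (x₂ • y) *ₗ ε x₁ *ₗ 1A    ≈⟨ *ₗ-homo ηε-linear (ε (x₂ • y)) x₁ ⟨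
           ηε (ε (x₂ • y) *ₗ x₁)       ∎) ⟩
    Σ[ x₁ ⊗ x₂ ∈ Δ x ] ηε (ε (x₂ • y) *ₗ x₁)
      ≈⟨ linear-ΣA ηε-linear _ (Δ x) ⟨
    ηε (Σ[ x₁ ⊗ x₂ ∈ Δ x ] ε (x₂ • y) *ₗ x₁)
      ≈⟨ ⟦⟧-cong ηε-linear (Σ-ε•*ₗ≈0ᴹ x y) ⟩
    ηε 0ᴹ
      ≈⟨ linear-0ᴹ ηε-linear ⟩
    0ᴹ ∎
    where
    ηε[•y]-linear : IsLinear (λ z → ηε (z • y))
    ηε[•y]-linear = ∘-linear ηε-linear (•-linearˡ y)

module AntipodeProperties
  {c ℓ} {K : Field c ℓ} {M : Module (Field.commutativeRing K) c ℓ}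
  (B : ComPreLieBialgebra K M) {S : Module.Carrierᴹ M → Module.Carrierᴹ M}
  (S-antipode : ComPreLieBialgebraTheory.IsAntipode B S) where
  open Module M
  open ComPreLieBialgebra B
  open ComPreLieBialgebraTheory.IsAntipode S-antipode
  open LinearAlgebra K M
  open ComPreLieBialgebraProperties B
  open GroupProperties +ᴹ-group using (inverseʳ-unique)
  open SetoidReasoning ≈ᴹ-setoid

  private
    A : Set c
    A = Carrierᴹ

  infixl 7 _⋆_
  _⋆_ : (A → A) → (A → A) → A → A
  (f ⋆ g) x = Σ[ x₁ ⊗ x₂ ∈ Δ x ] f x₁ · g x₂

  S-linear : IsLinear S
  S-linear = record { ⟦⟧-cong = S-cong ; +ᴹ-homo = S-+ ; *ₗ-homo = S-* }

  ⋆id⋆S : ∀ {f} → IsLinear f → ∀ x → ((f ⋆ id) ⋆ S) x ≈ᴹ f x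
  ⋆id⋆S {f} f-lin x = begin
    Σ[ x₁ ⊗ x₂ ∈ Δ x ] (Σ[ y₁ ⊗ y₂ ∈ Δ x₁ ] f y₁ · y₂) · S x₂
      ≈⟨ ΣA-cong (Δ x) (λ (x₁ , x₂) → linear-ΣA (·-linearˡ (S x₂)) _ (Δ x₁)) ⟩
    Σ[ x₁ ⊗ x₂ ∈ Δ x ] Σ[ y₁ ⊗ y₂ ∈ Δ x₁ ] f y₁ · y₂ · S x₂
      ≈⟨ Σ-Δ-coassoc trilinear x ⟩
    Σ[ x₁ ⊗ x₂ ∈ Δ x ] Σ[ y₁ ⊗ y₂ ∈ Δ x₂ ] f x₁ · y₁ · S y₂
      ≈⟨ ΣA-cong (Δ x) (λ (x₁ , x₂) →
           ≈ᴹ-trans (ΣA-cong (Δ x₂) (λ (y₁ , y₂) → ·-assoc (f x₁) y₁ (S y₂)))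
                    (≈ᴹ-sym (linear-ΣA (·-linearʳ (f x₁)) _ (Δ x₂)))) ⟩
    Σ[ x₁ ⊗ x₂ ∈ Δ x ] f x₁ · (id ⋆ S) x₂
      ≈⟨ ΣA-cong (Δ x) (λ (x₁ , x₂) → ≈ᴹ-trans (·-cong ≈ᴹ-refl (S-right x₂)) (·-ηε (f x₁) x₂)) ⟩
    Σ[ x₁ ⊗ x₂ ∈ Δ x ] ε x₂ *ₗ f x₁
      ≈⟨ linear-counitʳ f-lin x ⟩
    f x ∎
    where
    trilinear : IsTrilinear (λ u v w → f u · v · S w)
    trilinear = record
      { linear₁ = λ v w → ∘-linear (·-linearˡ (S w)) (∘-linear (·-linearˡ v) f-lin)
      ; linear₂ = λ u w → ∘-linear (·-linearˡ (S w)) (·-linearʳ (f u))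
      ; linear₃ = λ u v → ∘-linear (·-linearʳ (f u · v)) S-linear
      }

  ⋆id-injective : ∀ {f g} → IsLinear f → IsLinear g →
                  (∀ x → (f ⋆ id) x ≈ᴹ (g ⋆ id) x) → ∀ x → f x ≈ᴹ g x
  ⋆id-injective {f} {g} f-lin g-lin f⋆id≈g⋆id x = begin
    f x                ≈⟨ ⋆id⋆S f-lin x ⟨
    ((f ⋆ id) ⋆ S) x   ≈⟨ ΣA-cong (Δ x) (λ (x₁ , _) → ·-cong (f⋆id≈g⋆id x₁) ≈ᴹ-refl) ⟩
    ((g ⋆ id) ⋆ S) x   ≈⟨ ⋆id⋆S g-lin x ⟩
    g x                ∎

  [S•]⋆id+S⋆[•]≈0ᴹ : ∀ x y → ((λ u → S u • y) ⋆ id) x +ᴹ (S ⋆ (_• y)) x ≈ᴹ 0ᴹ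
  [S•]⋆id+S⋆[•]≈0ᴹ x y = begin
    ((λ u → S u • y) ⋆ id) x +ᴹ (S ⋆ (_• y)) x
      ≈⟨ ΣA-+ᴹ _ _ (Δ x) ⟨
    Σ[ x₁ ⊗ x₂ ∈ Δ x ] (S x₁ • y) · x₂ +ᴹ S x₁ · (x₂ • y)
      ≈⟨ ΣA-cong (Δ x) (λ (x₁ , x₂) → leibniz (S x₁) x₂ y) ⟨
    Σ[ x₁ ⊗ x₂ ∈ Δ x ] (S x₁ · x₂) • y
      ≈⟨ linear-ΣA (•-linearˡ y) _ (Δ x) ⟨
    (S ⋆ id) x • y      ≈⟨ •-cong (S-left x) ≈ᴹ-refl ⟩
    (ε x *ₗ 1A) • y     ≈⟨ •-scalarˡ (ε x) 1A y ⟩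
    ε x *ₗ (1A • y)     ≈⟨ *ₗ-congˡ (1A•≈0ᴹ y) ⟩
    ε x *ₗ 0ᴹ           ≈⟨ *ₗ-zeroʳ (ε x) ⟩
    0ᴹ                  ∎

  S⋆[•]+ΣS[•]·≈0ᴹ : ∀ x y →
    (S ⋆ (_• y)) x +ᴹ (Σ[ x₁ ⊗ x₂ ∈ Δ x ] Σ[ y₁ ⊗ y₂ ∈ Δ y ] S (x₁ • y₁) · (x₂ · y₂)) ≈ᴹ 0ᴹ
  S⋆[•]+ΣS[•]·≈0ᴹ x y = begin
    (S ⋆ (_• y)) x +ᴹ (Σ[ x₁ ⊗ x₂ ∈ Δ x ] Σ[ y₁ ⊗ y₂ ∈ Δ y ] S (x₁ • y₁) · (x₂ · y₂))
      ≈⟨ Σ-Δ-• S·-bilinear x y ⟨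
    (S ⋆ id) (x • y)  ≈⟨ S-left (x • y) ⟩
    ηε (x • y)        ≈⟨ ηε-•≈0ᴹ x y ⟩
    0ᴹ                ∎
    where
    S·-bilinear : IsBilinear (λ u v → S u · v)
    S·-bilinear = record
      { linearˡ = λ v → ∘-linear (·-linearˡ v) S-linear
      ; linearʳ = λ u → ·-linearʳ (S u)
      }

  ΣS[•]·≈[S•]⋆id : ∀ x y →
    Σ[ x₁ ⊗ x₂ ∈ Δ x ] Σ[ y₁ ⊗ y₂ ∈ Δ y ] S (x₁ • y₁) · (x₂ · y₂) ≈ᴹ ((λ u → S u • y) ⋆ id) x
  ΣS[•]·≈[S•]⋆id x y = begin
    Σ[ x₁ ⊗ x₂ ∈ Δ x ] Σ[ y₁ ⊗ y₂ ∈ Δ y ] S (x₁ • y₁) · (x₂ · y₂)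
      ≈⟨ inverseʳ-unique _ _ (S⋆[•]+ΣS[•]·≈0ᴹ x y) ⟩
    -ᴹ (S ⋆ (_• y)) x
      ≈⟨ inverseʳ-unique _ _ (≈ᴹ-trans (+ᴹ-comm _ _) ([S•]⋆id+S⋆[•]≈0ᴹ x y)) ⟨
    ((λ u → S u • y) ⋆ id) x ∎

  [S[•]]⋆id≈S• : ∀ x y → ((λ v → S (x • v)) ⋆ id) y ≈ᴹ S x • y
  [S[•]]⋆id≈S• x y = ⋆id-injective f-lin (∘-linear (•-linearˡ y) S-linear) f⋆id≈ x
    where
    f : A → A
    f u = ((λ v → S (u • v)) ⋆ id) y
    f-lin : IsLinear f
    f-lin = ΣA-linear (λ (y₁ , y₂) u → S (u • y₁) · y₂) (Δ y)
              (λ (y₁ , y₂) → ∘-linear (·-linearˡ y₂) (∘-linear S-linear (•-linearˡ y₁)))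
    f⋆id≈ : ∀ u → (f ⋆ id) u ≈ᴹ ((λ u → S u • y) ⋆ id) u
    f⋆id≈ u = begin
      Σ[ u₁ ⊗ u₂ ∈ Δ u ] (Σ[ y₁ ⊗ y₂ ∈ Δ y ] S (u₁ • y₁) · y₂) · u₂
        ≈⟨ ΣA-cong (Δ u) (λ (_ , u₂) → linear-ΣA (·-linearˡ u₂) _ (Δ y)) ⟩
      Σ[ u₁ ⊗ u₂ ∈ Δ u ] Σ[ y₁ ⊗ y₂ ∈ Δ y ] S (u₁ • y₁) · y₂ · u₂
        ≈⟨ ΣA-cong (Δ u) (λ (_ , u₂) → ΣA-cong (Δ y) (λ (_ , y₂) →
             ≈ᴹ-trans (·-assoc _ y₂ u₂) (·-cong ≈ᴹ-refl (·-comm y₂ u₂)))) ⟩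
      Σ[ u₁ ⊗ u₂ ∈ Δ u ] Σ[ y₁ ⊗ y₂ ∈ Δ y ] S (u₁ • y₁) · (u₂ · y₂)
        ≈⟨ ΣS[•]·≈[S•]⋆id u y ⟩
      ((λ u → S u • y) ⋆ id) u ∎

-- Characteristic zero and conilpotency only serve to guarantee that an antipode exists;
-- here it is given.
theorem1p3 : ∀ {c ℓ} (K : Field c ℓ) → CharacteristicZero K →
    (M : Module (Field.commutativeRing K) c ℓ) (B : ComPreLieBialgebra K M) →
    ComPreLieBialgebraTheory.Conilpotent B →
    (S : Module.Carrierᴹ M → Module.Carrierᴹ M) →
    ComPreLieBialgebraTheory.IsAntipode B S →
    let open Module M
        open Tensors K M
        open ComPreLieBialgebra B
    in ∀ a b → S (a • b) ≈ᴹ ΣA (map (λ { (b₁ , b₂) → (S a • b₁) · S b₂ }) (Δ b))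
theorem1p3 K _ M B _ S S-antipode a b = begin
  S (a • b)
    ≈⟨ ⋆id⋆S (∘-linear S-linear (•-linearʳ a)) b ⟨
  (((λ v → S (a • v)) ⋆ id) ⋆ S) b
    ≈⟨ ΣA-cong (Δ b) (λ (b₁ , _) → ·-cong ([S[•]]⋆id≈S• a b₁) ≈ᴹ-refl) ⟩
  ((S a •_) ⋆ S) b ∎
  where
  open Module M
  open ComPreLieBialgebra B
  open LinearAlgebra K M
  open ComPreLieBialgebraProperties B
  open AntipodeProperties B S-antipode
  open SetoidReasoning ≈ᴹ-setoid
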